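{- Let $n\geq 3$ be odd, $m\geq 2$, and let $\Gamma$ be an Abelian group of order $(2m-1)n$ having a cyclic subgroup of order $2m-1$. Then the generalized prism $Y_{m,n}=C_n\Box P_m$ admits a $\Gamma$-harmonious labeling.
   Context: The generalized prism $Y_{m,n}$ is the Cartesian product of the path on $m$ vertices and the cycle $C_n$; it has $(2m-1)n$ edges. For a graph $G=(V,E)$ with $q$ edges and a finite Abelian group $\Gamma$ of order $q$ (written additively), a $\Gamma$-harmonious labeling is an injection $f:V\to\Gamma$ such that the induced edge labeling $w(xy)=f(x)+f(y)$ is a bijection from $E$ to $\Gamma$. -}

module Defs where

open import Level using (Level)
open import Data.Nat using (ℕ; zero; suc; _∸_; _<_)
open import Data.Nat.DivMod using (_mod_)
open import Data.Fin using (Fin; toℕ; inject₁) renaming (suc to fsuc)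
open import Data.Product using (_×_; _,_; ∃)
open import Data.Sum using (_⊎_; inj₁; inj₂)
open import Relation.Nullary using (¬_)
open import Relation.Binary.PropositionalEquality using (_≡_)
import Relation.Binary.PropositionalEquality as ≡
open import Function.Definitions using (Injective; Bijective)
open import Function.Bundles using (Bijection)
open import Algebra.Bundles using (AbelianGroup)

-- A finite simple graph given by a vertex type, an edge type and the
-- endpoints of each edge (each edge listed exactly once).
record Graph : Set₁ where
  field
    Vertex : Set
    Edge   : Set
    ends   : Edge → Vertex × Vertex

cycSucc : ∀ {n} → Fin n → Fin n
cycSucc {suc n} j = suc (toℕ j) mod suc n

pathLower : (m : ℕ) → Fin (m ∸ 1) → Fin m
pathLower (suc m) i = inject₁ i

pathUpper : (m : ℕ) → Fin (m ∸ 1) → Fin m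
pathUpper (suc m) i = fsuc i

Prism : ℕ → ℕ → Graph
Prism m n = record
  { Vertex = Fin m × Fin n
  ; Edge   = (Fin m × Fin n) ⊎ (Fin (m ∸ 1) × Fin n)
  ; ends   = λ { (inj₁ (i , j)) → (i , j) , (i , cycSucc j)
               ; (inj₂ (i , j)) → (pathLower m i , j) , (pathUpper m i , j) }
  }

module _ {c ℓ : Level} (Γ : AbelianGroup c ℓ) where
  open AbelianGroup Γ

  HasOrder : ℕ → Set (c Level.⊔ ℓ)
  HasOrder q = Bijection setoid (≡.setoid (Fin q))

  times : ℕ → Carrier → Carrier
  times zero    g = ε
  times (suc k) g = g ∙ times k g

  HasCyclicSubgroupOfOrder : ℕ → Set (c Level.⊔ ℓ)
  HasCyclicSubgroupOfOrder k =
    ∃ λ g → times k g ≈ ε × (∀ i → 0 < i → i < k → ¬ (times i g ≈ ε))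

  -- Γ-harmonious labeling of a graph G (|E(G)| = |Γ| is implied by bijectivity)
  IsHarmonious : (G : Graph) → (Graph.Vertex G → Carrier) → Set (c Level.⊔ ℓ)
  IsHarmonious G f =
    Injective _≡_ _≈_ f ×
    Bijective _≡_ _≈_ (λ e → let (x , y) = Graph.ends G e in f x ∙ f y)

  HasHarmoniousLabeling : Graph → Set (c Level.⊔ ℓ)
  HasHarmoniousLabeling G = ∃ λ (f : Graph.Vertex G → Carrier) → IsHarmonious G f

{-# OPTIONS --safe #-}
module Submission where

-- Let h have order M = 2m − 1; |Γ| = M·n is odd, so in Γ and in all its
-- quotients x + x = y + y implies x = y.
--
-- Call an arrangement X₀, …, X_{N−1} of the elements of a group a harmonious
-- cycle if the cyclic neighbour sums X_a + X_{a+1} are pairwise distinct as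
-- well.  Such cycles lift along cyclic quotients: if z has order r and
-- B₀, …, B_{s−1} is a harmonious cycle of the quotient by ⟨z⟩, then
-- X_{ts+i} = B_i + t·z (t < r, i < s) is one of the group itself, since its
-- neighbour sums are B_i + B_{i+1} + (2t + carry)·z and doubling is injective
-- modulo the odd number r.  Quotienting by all elements one after another
-- shows that Γ/⟨h⟩ has a harmonious cycle X₀, …, X_{N−1}; every element of Γ
-- is X_a + t·h for unique a < N and t < M, so N·M = |Γ| and N = n.
--
-- Label vertex (i, j) of Y_{m,n} by X_{j+i} + i·h.  A cycle edge in row i gets
-- X_a + X_{a+1} + 2i·h and a path edge between rows i and i + 1 gets
-- X_a + X_{a+1} + (2i+1)·h, so the (2m − 1)·n edge labels are pairwise
-- distinct and therefore exhaust Γ.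

open import Defs
open import Level using (Level; _⊔_)
open import Data.Nat using (ℕ; zero; suc; pred; _+_; _*_; _∸_; _≤_; _<_; z≤n; s≤s; s≤s⁻¹; NonZero)
open import Data.Nat.Properties
open import Data.Nat.DivMod
open import Data.Nat.Divisibility using (n∣m*n)
open import Data.Fin as Fin using (Fin; toℕ; fromℕ<; inject₁; punchOut)
open import Data.Fin.Properties
  using (toℕ-injective; toℕ<n; toℕ-fromℕ<; toℕ-inject₁; any?; injective⇒≤; punchOut-injective;
         cantor-schröder-bernstein; +↔⊎; *↔×)
open import Function.Properties.Inverse using (↔-sym; ↔-trans)
open import Data.Sum.Function.Propositional using (_⊎-↔_)
open import Data.Product using (_×_; _,_; ∃; ∃₂; proj₁; proj₂; uncurry)
open import Data.Sum using (_⊎_; inj₁; inj₂; [_,_]′)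
open import Relation.Nullary using (yes; no; contradiction)
open import Relation.Binary.PropositionalEquality as ≡
  using (_≡_; _≢_; cong; cong₂; subst; module ≡-Reasoning)
open import Function.Definitions using (Injective; Surjective; StrictlySurjective)
open import Function.Bundles using (Bijection; _↔_; Inverse)
open import Function.Base using (_∘_; id)
open import Relation.Binary.Core using (Rel)
open import Relation.Binary.Definitions using (Decidable)
open import Relation.Binary.Structures using (IsEquivalence)
open import Algebra.Definitions using (Congruent₂)
open import Data.Nat.Tactic.RingSolver using (solve-∀)
open import Data.List using (List; []; _∷_; tabulate)
open import Data.List.Relation.Unary.Any as Any using (Any; here; there)
open import Algebra.Bundles using (AbelianGroup)

-- Natural numbers and finite sets

[1+n]+[1+n]≡[1+2n]+1 : ∀ n → suc n + suc n ≡ suc (2 * n) + 1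
[1+n]+[1+n]≡[1+2n]+1 = solve-∀

n+[1+n]≡1+2n : ∀ n → n + suc n ≡ suc (2 * n)
n+[1+n]≡1+2n = solve-∀

[1+2m]*[2k+1]≡1+2[2mk+m+k] : ∀ m k → suc (2 * m) * (2 * k + 1) ≡ suc (2 * (2 * m * k + m + k))
[1+2m]*[2k+1]≡1+2[2mk+m+k] = solve-∀

[1+m]n+mn≡n[1+2m] : ∀ m n → suc m * n + m * n ≡ n * suc (2 * m)
[1+m]n+mn≡n[1+2m] = solve-∀

[m+kn]/n≡m/n+k : ∀ m k n .{{_ : NonZero n}} → (m + k * n) / n ≡ m / n + k
[m+kn]/n≡m/n+k m k n = ≡.trans (+-distrib-/-∣ʳ m (n∣m*n k)) (cong (m / n +_) (m*n/n≡m k n))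

m+n*o<p*o : ∀ {m n o p} → m < o → n < p → m + n * o < p * o
m+n*o<p*o {m} {n} {o} {p} m<o n<p = begin-strict
  m + n * o  <⟨ +-monoˡ-< (n * o) m<o ⟩
  suc n * o  ≤⟨ *-monoˡ-≤ o n<p ⟩
  p * o      ∎
  where open ≤-Reasoning

%-/-injective : ∀ {m n d} .{{_ : NonZero d}} → m % d ≡ n % d → m / d ≡ n / d → m ≡ n
%-/-injective {m} {n} {d} eq₁ eq₂ = begin
  m                 ≡⟨ m≡m%n+[m/n]*n m d ⟩
  m % d + m / d * d ≡⟨ cong₂ (λ a b → a + b * d) eq₁ eq₂ ⟩
  n % d + n / d * d ≡⟨ m≡m%n+[m/n]*n n d ⟨
  n                 ∎
  where open ≡-Reasoning

+-%-congˡ : ∀ {m n} o {d} .{{_ : NonZero d}} → m % d ≡ n % d → (m + o) % d ≡ (n + o) % d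
+-%-congˡ {m} {n} o {d} eq = begin
  (m + o) % d         ≡⟨ %-distribˡ-+ m o d ⟩
  (m % d + o % d) % d ≡⟨ cong (λ v → (v + o % d) % d) eq ⟩
  (n % d + o % d) % d ≡⟨ %-distribˡ-+ n o d ⟨
  (n + o) % d         ∎
  where open ≡-Reasoning

suc-%-injective : ∀ {m n d} .{{_ : NonZero d}} → m < d → n < d → suc m % d ≡ suc n % d → m ≡ n
suc-%-injective {m} {n} {d} m<d n<d eq = begin
  m                    ≡⟨ unwind m<d ⟨
  (suc m + pred d) % d ≡⟨ +-%-congˡ (pred d) eq ⟩
  (suc n + pred d) % d ≡⟨ unwind n<d ⟩
  n                    ∎
  where
  open ≡-Reasoning
  unwind : ∀ {k} → k < d → (suc k + pred d) % d ≡ k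
  unwind {k} k<d = begin
    (suc k + pred d) % d ≡⟨ cong (_% d) (≡.trans (≡.sym (+-suc k (pred d))) (cong (k +_) (suc-pred d))) ⟩
    (k + d) % d          ≡⟨ [m+n]%n≡m%n k d ⟩
    k % d                ≡⟨ m<n⇒m%n≡m k<d ⟩
    k                    ∎

toℕ-cycSucc : ∀ {n} .{{_ : NonZero n}} (j : Fin n) → toℕ (cycSucc j) ≡ suc (toℕ j) % n
toℕ-cycSucc {suc n} j = toℕ-fromℕ< _

cycSucc-injective : ∀ {n} → Injective _≡_ _≡_ (cycSucc {n})
cycSucc-injective {suc n} {i} {j} eq = toℕ-injective (suc-%-injective (toℕ<n i) (toℕ<n j) (begin
  suc (toℕ i) % suc n ≡⟨ toℕ-cycSucc i ⟨
  toℕ (cycSucc i)     ≡⟨ cong toℕ eq ⟩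
  toℕ (cycSucc j)     ≡⟨ toℕ-cycSucc j ⟩
  suc (toℕ j) % suc n ∎))
  where open ≡-Reasoning

injective⇒surjective : ∀ {n} {f : Fin n → Fin n} → Injective _≡_ _≡_ f → StrictlySurjective _≡_ f
injective⇒surjective {suc n} {f} f-injective y with any? (λ x → f x Fin.≟ y)
... | yes found = found
... | no ¬found = contradiction (injective⇒≤ punchOut∘f-injective) 1+n≰n
  where
  y≢f : ∀ x → y ≢ f x
  y≢f x eq = ¬found (x , ≡.sym eq)
  punchOut∘f-injective : Injective _≡_ _≡_ (λ x → punchOut (y≢f x))
  punchOut∘f-injective eq = f-injective (punchOut-injective (y≢f _) (y≢f _) eq)

-- Multiples, orders and quotients in abelian groups

module _ {c ℓ} (G : AbelianGroup c ℓ) where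
  open AbelianGroup G
  open import Algebra.Properties.AbelianGroup G using (∙-cancelˡ; ∙-cancelʳ; //-rightDividesʳ)
  open import Algebra.Properties.CommutativeSemigroup commutativeSemigroup using (interchange; xy∙z≈xz∙y)
  open import Algebra.Properties.CommutativeMonoid.Mult commutativeMonoid
    using (×-homo-+; ×-homo-1; ×-assocˡ; ×-congʳ; ×-distrib-+) renaming (_×_ to _·_)
  open import Algebra.Properties.Monoid.Sum monoid using (sum-replicate; sum-replicate-zero)
  open import Relation.Binary.Reasoning.Setoid setoid

  ·-ε : ∀ n → n · ε ≈ ε
  ·-ε n = trans (sym (sum-replicate n)) (sum-replicate-zero n)

  HasOddExponent : Set (c ⊔ ℓ)
  HasOddExponent = ∃ λ e → ∀ w → suc (2 * e) · w ≈ ε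

  halve : HasOddExponent → ∀ {x y} → x ∙ x ≈ y ∙ y → x ≈ y
  halve (e , odd) {x} {y} eq = begin
    x                  ≈⟨ undouble x ⟨
    suc e · (x ∙ x)    ≈⟨ ×-congʳ (suc e) eq ⟩
    suc e · (y ∙ y)    ≈⟨ undouble y ⟩
    y                  ∎
    where
    undouble : ∀ w → suc e · (w ∙ w) ≈ w
    undouble w = begin
      suc e · (w ∙ w)        ≈⟨ ×-distrib-+ w w (suc e) ⟩
      suc e · w ∙ suc e · w  ≈⟨ ×-homo-+ w (suc e) (suc e) ⟨
      (suc e + suc e) · w    ≡⟨ cong (_· w) ([1+n]+[1+n]≡[1+2n]+1 e) ⟩
      (suc (2 * e) + 1) · w  ≈⟨ ×-homo-+ w (suc (2 * e)) 1 ⟩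
      suc (2 * e) · w ∙ 1 · w ≈⟨ ∙-cong (odd w) (×-homo-1 w) ⟩
      ε ∙ w                  ≈⟨ identityˡ w ⟩
      w                      ∎

  ∙-cancelˡ-≈ : ∀ {x y u v} → x ≈ y → x ∙ u ≈ y ∙ v → u ≈ v
  ∙-cancelˡ-≈ {x} x≈y eq = ∙-cancelˡ x _ _ (trans eq (∙-congʳ (sym x≈y)))

  quotient : ∀ {ℓ′} {_∼_ : Rel Carrier ℓ′} → IsEquivalence _∼_ → (∀ {x y} → x ≈ y → x ∼ y) →
             Congruent₂ _∼_ _∙_ → AbelianGroup c ℓ′
  quotient {_∼_ = _∼_} ∼-isEquivalence ≈⇒∼ ∙-cong′ = record
    { _≈_ = _∼_
    ; _∙_ = _∙_
    ; ε = ε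
    ; _⁻¹ = _⁻¹
    ; isAbelianGroup = record
      { isGroup = record
        { isMonoid = record
          { isSemigroup = record
            { isMagma = record { isEquivalence = ∼-isEquivalence ; ∙-cong = ∙-cong′ }
            ; assoc = λ x y z → ≈⇒∼ (assoc x y z)
            }
          ; identity = (λ x → ≈⇒∼ (identityˡ x)) , (λ x → ≈⇒∼ (identityʳ x))
          }
        ; inverse = (λ x → ≈⇒∼ (inverseˡ x)) , (λ x → ≈⇒∼ (inverseʳ x))
        ; ⁻¹-cong = ⁻¹-cong′
        }
      ; comm = λ x y → ≈⇒∼ (comm x y)
      }
    }
    where
    open IsEquivalence ∼-isEquivalence renaming (refl to ∼-refl; sym to ∼-sym; trans to ∼-trans)
    -- x⁻¹ ≈ (x⁻¹ ∙ y) ∙ y⁻¹ ∼ (x⁻¹ ∙ x) ∙ y⁻¹ ≈ y⁻¹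
    ⁻¹-cong′ : ∀ {x y} → x ∼ y → (x ⁻¹) ∼ (y ⁻¹)
    ⁻¹-cong′ {x} {y} x∼y =
      ∼-trans (≈⇒∼ (sym (//-rightDividesʳ y (x ⁻¹))))
        (∼-trans (∙-cong′ (∙-cong′ ∼-refl (∼-sym x∼y)) ∼-refl)
          (≈⇒∼ (trans (∙-congʳ (inverseˡ x)) (identityˡ (y ⁻¹)))))

  -- Congruence modulo ⟨z⟩, with a multiple of z on each side so that it is an
  -- equivalence relation without reference to the order of z.
  module Mod (z : Carrier) where
    infix 4 _≈ᶻ_
    _≈ᶻ_ : Rel Carrier ℓ
    x ≈ᶻ y = ∃₂ λ a b → x ∙ a · z ≈ y ∙ b · z

    ≈⇒≈ᶻ : ∀ {x y} → x ≈ y → x ≈ᶻ y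
    ≈⇒≈ᶻ x≈y = 0 , 0 , ∙-congʳ x≈y

    ≈ᶻ-trans : ∀ {x y w} → x ≈ᶻ y → y ≈ᶻ w → x ≈ᶻ w
    ≈ᶻ-trans {x} {y} {w} (a , b , eq₁) (a′ , b′ , eq₂) = a + a′ , b′ + b , (begin
      x ∙ (a + a′) · z        ≈⟨ ∙-congˡ (×-homo-+ z a a′) ⟩
      x ∙ (a · z ∙ a′ · z)    ≈⟨ assoc x _ _ ⟨
      x ∙ a · z ∙ a′ · z      ≈⟨ ∙-congʳ eq₁ ⟩
      y ∙ b · z ∙ a′ · z      ≈⟨ xy∙z≈xz∙y y _ _ ⟩
      y ∙ a′ · z ∙ b · z      ≈⟨ ∙-congʳ eq₂ ⟩
      w ∙ b′ · z ∙ b · z      ≈⟨ assoc w _ _ ⟩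
      w ∙ (b′ · z ∙ b · z)    ≈⟨ ∙-congˡ (×-homo-+ z b′ b) ⟨
      w ∙ (b′ + b) · z        ∎)

    ≈ᶻ-isEquivalence : IsEquivalence _≈ᶻ_
    ≈ᶻ-isEquivalence = record
      { refl  = ≈⇒≈ᶻ refl
      ; sym   = λ { (a , b , eq) → b , a , sym eq }
      ; trans = ≈ᶻ-trans
      }

    z≈ᶻε : z ≈ᶻ ε
    z≈ᶻε = 0 , 1 , trans (identityʳ z) (sym (trans (identityˡ _) (identityʳ z)))

    ∙-congᶻ : Congruent₂ _≈ᶻ_ _∙_
    ∙-congᶻ {x} {y} {u} {v} (a , b , eq₁) (a′ , b′ , eq₂) = a + a′ , b + b′ , (begin
      x ∙ u ∙ (a + a′) · z      ≈⟨ ∙-congˡ (×-homo-+ z a a′) ⟩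
      x ∙ u ∙ (a · z ∙ a′ · z)  ≈⟨ interchange x u _ _ ⟩
      x ∙ a · z ∙ (u ∙ a′ · z)  ≈⟨ ∙-cong eq₁ eq₂ ⟩
      y ∙ b · z ∙ (v ∙ b′ · z)  ≈⟨ interchange y _ v _ ⟩
      y ∙ v ∙ (b · z ∙ b′ · z)  ≈⟨ ∙-congˡ (×-homo-+ z b b′) ⟨
      y ∙ v ∙ (b + b′) · z      ∎)

  record IsOrderOf (z : Carrier) (r : ℕ) : Set ℓ where
    field
      {{nonZero}} : NonZero r
      annihilates : r · z ≈ ε
      minimal     : ∀ {t} → t < r → t · z ≈ ε → t ≡ 0

  times≡· : ∀ n x → times G n x ≡ n · x
  times≡· zero    x = ≡.refl
  times≡· (suc n) x = cong (x ∙_) (times≡· n x)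

  cyclicSubgroup⇒order : ∀ {r} {{_ : NonZero r}} → HasCyclicSubgroupOfOrder G r → ∃ λ z → IsOrderOf z r
  cyclicSubgroup⇒order {r} (z , r×z≈ε , r-minimal) = z , record
    { annihilates = subst (_≈ ε) (times≡· r z) r×z≈ε
    ; minimal     = minimal
    }
    where
    minimal : ∀ {t} → t < r → t · z ≈ ε → t ≡ 0
    minimal {zero}  _   _     = ≡.refl
    minimal {suc t} t<r t·z≈ε =
      contradiction (subst (_≈ ε) (≡.sym (times≡· (suc t) z)) t·z≈ε) (r-minimal (suc t) (s≤s z≤n) t<r)

  module Order {z r} (order : IsOrderOf z r) where
    open IsOrderOf order

    ·-%-order : ∀ t → (t % r) · z ≈ t · z
    ·-%-order t = begin
      (t % r) · z                     ≈⟨ identityʳ _ ⟨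
      (t % r) · z ∙ ε                 ≈⟨ ∙-congˡ (·-ε (t / r)) ⟨
      (t % r) · z ∙ (t / r) · ε       ≈⟨ ∙-congˡ (×-congʳ (t / r) annihilates) ⟨
      (t % r) · z ∙ (t / r) · r · z   ≈⟨ ∙-congˡ (×-assocˡ z (t / r) r) ⟩
      (t % r) · z ∙ (t / r * r) · z   ≈⟨ ×-homo-+ z (t % r) (t / r * r) ⟨
      (t % r + t / r * r) · z         ≡⟨ cong (_· z) (m≡m%n+[m/n]*n t r) ⟨
      t · z                           ∎

    ∸-annihilates : ∀ {t u} → u ≤ t → t · z ≈ u · z → (t ∸ u) · z ≈ ε
    ∸-annihilates {t} {u} u≤t eq = ∙-cancelʳ (u · z) _ _ (begin
      (t ∸ u) · z ∙ u · z  ≈⟨ ×-homo-+ z (t ∸ u) u ⟨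
      (t ∸ u + u) · z      ≡⟨ cong (_· z) (m∸n+n≡m u≤t) ⟩
      t · z                ≈⟨ eq ⟩
      u · z                ≈⟨ identityˡ _ ⟨
      ε ∙ u · z            ∎)

    ·-injective-≤ : ∀ {t u} → u ≤ t → t < r → t · z ≈ u · z → t ≡ u
    ·-injective-≤ {t} {u} u≤t t<r eq =
      ≤-antisym (m∸n≡0⇒m≤n (minimal (≤-<-trans (m∸n≤m t u) t<r) (∸-annihilates u≤t eq))) u≤t

    ·-injective : ∀ {t u} → t < r → u < r → t · z ≈ u · z → t ≡ u
    ·-injective {t} {u} t<r u<r eq with ≤-total u t
    ... | inj₁ u≤t = ·-injective-≤ u≤t t<r eq
    ... | inj₂ t≤u = ≡.sym (·-injective-≤ t≤u u<r (sym eq))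

    ·-double-injective : HasOddExponent → ∀ {a t u} → t < r → u < r →
                         (a + (t + t)) · z ≈ (a + (u + u)) · z → t ≡ u
    ·-double-injective odd {a} {t} {u} t<r u<r eq = ·-injective t<r u<r (halve odd (begin
      t · z ∙ t · z  ≈⟨ ×-homo-+ z t t ⟨
      (t + t) · z    ≈⟨ ∙-cancelˡ (a · z) _ _ (begin
        a · z ∙ (t + t) · z  ≈⟨ ×-homo-+ z a (t + t) ⟨
        (a + (t + t)) · z    ≈⟨ eq ⟩
        (a + (u + u)) · z    ≈⟨ ×-homo-+ z a (u + u) ⟩
        a · z ∙ (u + u) · z  ∎) ⟩
      (u + u) · z    ≈⟨ ×-homo-+ z u u ⟩
      u · z ∙ u · z  ∎))

    ·-negate : ∀ a → a · z ∙ (a * pred r) · z ≈ ε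
    ·-negate a = begin
      a · z ∙ (a * pred r) · z  ≈⟨ ×-homo-+ z a (a * pred r) ⟨
      (a + a * pred r) · z      ≡⟨ cong (_· z) (≡.trans (≡.sym (*-suc a (pred r))) (cong (a *_) (suc-pred r))) ⟩
      (a * r) · z               ≈⟨ ×-assocˡ z a r ⟨
      a · r · z                 ≈⟨ ×-congʳ a annihilates ⟩
      a · ε                     ≈⟨ ·-ε a ⟩
      ε                         ∎

    open Mod z

    representative : ∀ {x y} → x ≈ᶻ y → ∃ λ t → t < r × x ≈ y ∙ t · z
    representative {x} {y} (a , b , eq) = (b + a * pred r) % r , m%n<n _ r , (begin
      x                                     ≈⟨ identityʳ x ⟨
      x ∙ ε                                 ≈⟨ ∙-congˡ (·-negate a) ⟨
      x ∙ (a · z ∙ (a * pred r) · z)        ≈⟨ assoc x _ _ ⟨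
      x ∙ a · z ∙ (a * pred r) · z          ≈⟨ ∙-congʳ eq ⟩
      y ∙ b · z ∙ (a * pred r) · z          ≈⟨ assoc y _ _ ⟩
      y ∙ (b · z ∙ (a * pred r) · z)        ≈⟨ ∙-congˡ (×-homo-+ z b (a * pred r)) ⟨
      y ∙ (b + a * pred r) · z              ≈⟨ ∙-congˡ (·-%-order (b + a * pred r)) ⟨
      y ∙ ((b + a * pred r) % r) · z        ∎)

    ∙·-injective : ∀ {n} {Y : ℕ → Carrier} → (∀ {a b} → a < n → b < n → Y a ≈ᶻ Y b → a ≡ b) →
                   ∀ {a b t u} → a < n → b < n → t < r → u < r → Y a ∙ t · z ≈ Y b ∙ u · z → a ≡ b × t ≡ u
    ∙·-injective {Y = Y} Y-injective {a} {b} {t} {u} a<n b<n t<r u<r eq =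
      a≡b , ·-injective t<r u<r (∙-cancelˡ-≈ (reflexive (cong Y a≡b)) eq)
      where
      a≡b : a ≡ b
      a≡b = Y-injective a<n b<n (t , u , eq)

    ≈ᶻ-decidable : Decidable _≈_ → Decidable _≈ᶻ_
    ≈ᶻ-decidable _≟_ x y with any? (λ (t : Fin r) → x ≟ (y ∙ toℕ t · z))
    ... | yes (t , eq) = yes (0 , toℕ t , trans (identityʳ x) eq)
    ... | no ¬found = no λ x≈ᶻy →
      let t , t<r , eq = representative x≈ᶻy
      in ¬found (fromℕ< t<r , trans eq (∙-congˡ (reflexive (cong (_· z) (≡.sym (toℕ-fromℕ< t<r))))))

  module _ (_≟_ : Decidable _≈_) (z : Carrier) where
    private
      search : ∀ n → ∃ (IsOrderOf z) ⊎ (∀ {t} → t ≤ n → t · z ≈ ε → t ≡ 0)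
      search zero = inj₂ λ { z≤n _ → ≡.refl }
      search (suc n) with search n
      ... | inj₁ found = inj₁ found
      ... | inj₂ none with (suc n · z) ≟ ε
      ...   | yes ann = inj₁ (suc n , record { annihilates = ann ; minimal = λ t<1+n → none (s≤s⁻¹ t<1+n) })
      ...   | no ¬ann = inj₂ below
        where
        below : ∀ {t} → t ≤ suc n → t · z ≈ ε → t ≡ 0
        below t≤1+n t·z≈ε with m≤n⇒m<n∨m≡n t≤1+n
        ... | inj₁ t<1+n = none (s≤s⁻¹ t<1+n) t·z≈ε
        ... | inj₂ ≡.refl = contradiction t·z≈ε ¬ann

    orderOf : ∀ {n} → suc n · z ≈ ε → ∃ (IsOrderOf z)
    orderOf {n} ann with search (suc n)
    ... | inj₁ found = found
    ... | inj₂ none = contradiction (none ≤-refl ann) λ ()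

_/⟨_⟩ : ∀ {c ℓ} (G : AbelianGroup c ℓ) → AbelianGroup.Carrier G → AbelianGroup c ℓ
G /⟨ z ⟩ = quotient G ≈ᶻ-isEquivalence ≈⇒≈ᶻ ∙-congᶻ
  where open Mod G z

-- Harmonious cycles

-- A G-harmonious labelling of the cycle C_length that is bijective on the
-- vertices as well; only the values of vertex below length matter.
record HarmoniousCycle {c ℓ} (G : AbelianGroup c ℓ) : Set (c ⊔ ℓ) where
  open AbelianGroup G
  field
    length             : ℕ
    {{length-nonZero}} : NonZero length
    vertex             : ℕ → Carrier
    vertex-injective   : ∀ {a b} → a < length → b < length → vertex a ≈ vertex b → a ≡ b
    vertex-surjective  : ∀ y → ∃ λ a → a < length × y ≈ vertex a
    edge-injective     : ∀ {a b} → a < length → b < length →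
                         vertex a ∙ vertex (suc a % length) ≈ vertex b ∙ vertex (suc b % length) → a ≡ b

module _ {c ℓ} (G : AbelianGroup c ℓ) where
  open AbelianGroup G
  open import Algebra.Properties.CommutativeSemigroup commutativeSemigroup using (interchange; x∙yz≈y∙xz)
  open import Algebra.Properties.CommutativeMonoid.Mult commutativeMonoid
    using (×-homo-+) renaming (_×_ to _·_)
  open import Relation.Binary.Reasoning.Setoid setoid

  module _ (z : Carrier) where
    open Mod G z
    open import Algebra.Properties.CommutativeMonoid.Mult (AbelianGroup.commutativeMonoid (G /⟨ z ⟩))
      using () renaming (_×_ to _·ᶻ_)

    ·ᶻ≡· : ∀ n w → n ·ᶻ w ≡ n · w
    ·ᶻ≡· zero    w = ≡.refl
    ·ᶻ≡· (suc n) w = cong (w ∙_) (·ᶻ≡· n w)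

    hasOddExponent-/⟨⟩ : HasOddExponent G → HasOddExponent (G /⟨ z ⟩)
    hasOddExponent-/⟨⟩ (e , odd) = e , λ w → subst (_≈ᶻ ε) (≡.sym (·ᶻ≡· (suc (2 * e)) w)) (≈⇒≈ᶻ (odd w))

  trivialCycle : (∀ y → y ≈ ε) → HarmoniousCycle G
  trivialCycle trivial = record
    { length            = 1
    ; vertex            = λ _ → ε
    ; vertex-injective  = λ { (s≤s z≤n) (s≤s z≤n) _ → ≡.refl }
    ; vertex-surjective = λ y → 0 , s≤s z≤n , trivial y
    ; edge-injective    = λ { (s≤s z≤n) (s≤s z≤n) _ → ≡.refl }
    }

  module Refinement (odd : HasOddExponent G) {z r} (order : IsOrderOf G z r)
                    (coarse : HarmoniousCycle (G /⟨ z ⟩)) where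
    open Order G order
    open HarmoniousCycle coarse renaming
      (length to s; vertex to B; vertex-injective to B-injective;
       vertex-surjective to B-surjective; edge-injective to B-edge-injective)

    instance
      r*s-nonZero : NonZero (r * s)
      r*s-nonZero = m*n≢0 r s

    -- Go r times around the coarse cycle, the t-th time shifted by t·z.
    X : ℕ → Carrier
    X k = B (k % s) ∙ (k / s) · z

    X-periodic : ∀ k → X (k % (r * s)) ≈ X k
    X-periodic k = begin
      B (k % (r * s) % s) ∙ (k % (r * s) / s) · z
        ≡⟨ cong₂ (λ i t → B i ∙ t · z) (m∣n⇒o%n%m≡o%m s (r * s) k (n∣m*n r)) (m%[n*o]/o≡m/o%n k r s) ⟩
      B (k % s) ∙ (k / s % r) · z
        ≈⟨ ∙-congˡ (·-%-order (k / s)) ⟩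
      B (k % s) ∙ (k / s) · z
        ∎

    X-suc : ∀ k → X (suc k) ≡ B (suc (k % s) % s) ∙ (suc (k % s) / s + k / s) · z
    X-suc k = ≡.trans (cong (X ∘ suc) (m≡m%n+[m/n]*n k s))
      (cong₂ (λ i t → B i ∙ t · z) ([m+kn]%n≡m%n (suc (k % s)) (k / s) s) ([m+kn]/n≡m/n+k (suc (k % s)) (k / s) s))

    coarseEdge : ℕ → Carrier
    coarseEdge i = B i ∙ B (suc i % s)

    edgeExponent : ℕ → ℕ
    edgeExponent k = suc (k % s) / s + (k / s + k / s)

    X-edge : ∀ k → X k ∙ X (suc k % (r * s)) ≈ coarseEdge (k % s) ∙ edgeExponent k · z
    X-edge k = begin
      X k ∙ X (suc k % (r * s))                  ≈⟨ ∙-congˡ (X-periodic (suc k)) ⟩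
      X k ∙ X (suc k)                            ≡⟨ cong (X k ∙_) (X-suc k) ⟩
      B i ∙ t · z ∙ (B i′ ∙ (carry + t) · z)     ≈⟨ interchange (B i) _ _ _ ⟩
      B i ∙ B i′ ∙ (t · z ∙ (carry + t) · z)     ≈⟨ ∙-congˡ (∙-congˡ (×-homo-+ z carry t)) ⟩
      B i ∙ B i′ ∙ (t · z ∙ (carry · z ∙ t · z)) ≈⟨ ∙-congˡ (x∙yz≈y∙xz (t · z) _ _) ⟩
      B i ∙ B i′ ∙ (carry · z ∙ (t · z ∙ t · z)) ≈⟨ ∙-congˡ (∙-congˡ (×-homo-+ z t t)) ⟨
      B i ∙ B i′ ∙ (carry · z ∙ (t + t) · z)     ≈⟨ ∙-congˡ (×-homo-+ z carry (t + t)) ⟨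
      B i ∙ B i′ ∙ (carry + (t + t)) · z         ∎
      where
      i i′ carry t : ℕ
      i = k % s
      i′ = suc i % s
      carry = suc i / s
      t = k / s

    X-injective : ∀ {k l} → k < r * s → l < r * s → X k ≈ X l → k ≡ l
    X-injective {k} {l} k<rs l<rs eq = uncurry %-/-injective
      (∙·-injective B-injective (m%n<n k s) (m%n<n l s) (m<n*o⇒m/o<n k<rs) (m<n*o⇒m/o<n l<rs) eq)

    X-surjective : ∀ y → ∃ λ k → k < r * s × y ≈ X k
    X-surjective y with B-surjective y
    ... | i , i<s , y≈ᶻBi with representative y≈ᶻBi
    ...   | t , t<r , y≈Bi∙t·z = i + t * s , m+n*o<p*o i<s t<r , (begin
      y
        ≈⟨ y≈Bi∙t·z ⟩
      B i ∙ t · z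
        ≡⟨ cong₂ (λ j u → B j ∙ u · z) (m<n⇒m%n≡m i<s) (cong (_+ t) (m<n⇒m/n≡0 i<s)) ⟨
      B (i % s) ∙ (i / s + t) · z
        ≡⟨ cong₂ (λ j u → B j ∙ u · z) ([m+kn]%n≡m%n i t s) ([m+kn]/n≡m/n+k i t s) ⟨
      X (i + t * s)
        ∎)

    X-edge-injective : ∀ {k l} → k < r * s → l < r * s →
                       X k ∙ X (suc k % (r * s)) ≈ X l ∙ X (suc l % (r * s)) → k ≡ l
    X-edge-injective {k} {l} k<rs l<rs eq =
      %-/-injective i≡j (·-double-injective odd {suc (k % s) / s} (m<n*o⇒m/o<n k<rs) (m<n*o⇒m/o<n l<rs) exponents)
      where
      coarse-eq : coarseEdge (k % s) ∙ edgeExponent k · z ≈ coarseEdge (l % s) ∙ edgeExponent l · z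
      coarse-eq = trans (sym (X-edge k)) (trans eq (X-edge l))
      i≡j : k % s ≡ l % s
      i≡j = B-edge-injective (m%n<n k s) (m%n<n l s) (edgeExponent k , edgeExponent l , coarse-eq)
      exponents : (suc (k % s) / s + (k / s + k / s)) · z ≈ (suc (k % s) / s + (l / s + l / s)) · z
      exponents = trans (∙-cancelˡ-≈ G (reflexive (cong coarseEdge i≡j)) coarse-eq)
                        (reflexive (cong (λ i → (suc i / s + (l / s + l / s)) · z) (≡.sym i≡j)))

    refined : HarmoniousCycle G
    refined = record
      { length            = r * s
      ; vertex            = X
      ; vertex-injective  = X-injective
      ; vertex-surjective = X-surjective
      ; edge-injective    = X-edge-injective
      }

-- Quotienting by the head of zs turns it into ε, so the hypothesis on zs
-- passes to the tail.
harmoniousCycle : ∀ {c ℓ} (G : AbelianGroup c ℓ) → let open AbelianGroup G in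
                  Decidable _≈_ → HasOddExponent G →
                  (zs : List Carrier) → (∀ y → y ≈ ε ⊎ Any (y ≈_) zs) → HarmoniousCycle G
harmoniousCycle G _ _ [] generated = trivialCycle G λ y → [ id , (λ ()) ]′ (generated y)
harmoniousCycle G _≟_ odd@(e , odd-e) (z ∷ zs) generated with orderOf G _≟_ z {2 * e} (odd-e z)
... | r , order = Refinement.refined G odd order
  (harmoniousCycle (G /⟨ z ⟩) (Order.≈ᶻ-decidable G order _≟_) (hasOddExponent-/⟨⟩ G z odd) zs generated′)
  where
  open AbelianGroup G
  open Mod G z
  generated′ : ∀ y → y ≈ᶻ ε ⊎ Any (y ≈ᶻ_) zs
  generated′ y with generated y
  ... | inj₁ y≈ε         = inj₁ (≈⇒≈ᶻ y≈ε)
  ... | inj₂ (here y≈z)  = inj₁ (≈ᶻ-trans (≈⇒≈ᶻ y≈z) z≈ᶻε)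
  ... | inj₂ (there y∈zs) = inj₂ (Any.map ≈⇒≈ᶻ y∈zs)

-- Finite abelian groups

module _ {c ℓ} (Γ : AbelianGroup c ℓ) {q} (|Γ|≡q : HasOrder Γ q) where
  open AbelianGroup Γ
  open Bijection |Γ|≡q using (to; injective; strictlySurjective) renaming (cong to to-cong)
  open import Algebra.Properties.AbelianGroup Γ using (∙-cancelˡ)
  open import Algebra.Properties.CommutativeMonoid.Sum commutativeMonoid
    using (sum; sum-permute; ∑-distrib-+; sum-cong-≋; sum-replicate)
  open import Algebra.Properties.CommutativeMonoid.Mult commutativeMonoid using () renaming (_×_ to _·_)
  open import Data.Fin.Permutation using (Permutation; permutation)
  open import Data.List.Relation.Unary.Any.Properties using (tabulate⁺)
  open import Relation.Binary.Reasoning.Setoid setoid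

  element : Fin q → Carrier
  element k = proj₁ (strictlySurjective k)

  to∘element : ∀ k → to (element k) ≡ k
  to∘element k = proj₂ (strictlySurjective k)

  element∘to : ∀ y → element (to y) ≈ y
  element∘to y = injective (to∘element (to y))

  ≈-decidable : Decidable _≈_
  ≈-decidable x y with to x Fin.≟ to y
  ... | yes tx≡ty = yes (injective tx≡ty)
  ... | no tx≢ty  = no (tx≢ty ∘ to-cong)

  enumerated : ∀ y → Any (y ≈_) (tabulate element)
  enumerated y = tabulate⁺ (to y) (sym (element∘to y))

  translate : Carrier → Fin q → Fin q
  translate w k = to (element k ∙ w)

  translate-cancel : ∀ {u v} → u ∙ v ≈ ε → ∀ k → translate v (translate u k) ≡ k
  translate-cancel {u} {v} u∙v≈ε k = ≡.trans (to-cong (begin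
    element (to (element k ∙ u)) ∙ v  ≈⟨ ∙-congʳ (element∘to _) ⟩
    element k ∙ u ∙ v                 ≈⟨ assoc _ u v ⟩
    element k ∙ (u ∙ v)               ≈⟨ ∙-congˡ u∙v≈ε ⟩
    element k ∙ ε                     ≈⟨ identityʳ _ ⟩
    element k                         ∎)) (to∘element k)

  -- Translation by w permutes the elements, so Σ element ≈ Σ element ∙ q·w.
  ·-order : ∀ w → q · w ≈ ε
  ·-order w = sym (∙-cancelˡ (sum element) _ _ (begin
    sum element ∙ ε                     ≈⟨ identityʳ _ ⟩
    sum element                         ≈⟨ sum-permute element translation ⟩
    sum (element ∘ translate w)         ≈⟨ sum-cong-≋ (λ k → element∘to (element k ∙ w)) ⟩
    sum (λ k → element k ∙ w)           ≈⟨ ∑-distrib-+ element (λ _ → w) ⟩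
    sum element ∙ sum {q} (λ _ → w)     ≈⟨ ∙-congˡ (sum-replicate q) ⟩
    sum element ∙ q · w                 ∎))
    where
    translation : Permutation q q
    translation = permutation (translate w) (translate (w ⁻¹))
      (translate-cancel (inverseˡ w)) (translate-cancel (inverseʳ w))

  odd-order⇒hasOddExponent : ∀ {e} → q ≡ suc (2 * e) → HasOddExponent Γ
  odd-order⇒hasOddExponent {e} q≡1+2e = e , λ w → subst (λ n → n · w ≈ ε) q≡1+2e (·-order w)

  module _ {a} {A : Set a} {n} (A↔Fin : A ↔ Fin n) (f : A → Carrier) (f-injective : Injective _≡_ _≈_ f) where
    open Inverse A↔Fin using (from; strictlyInverseˡ; strictlyInverseʳ) renaming (to to index)

    private
      index-injective : Injective _≡_ _≡_ index
      index-injective eq = ≡.trans (≡.sym (strictlyInverseʳ _)) (≡.trans (cong from eq) (strictlyInverseʳ _))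

      to∘f∘from-injective : Injective _≡_ _≡_ (to ∘ f ∘ from)
      to∘f∘from-injective eq = ≡.trans (≡.sym (strictlyInverseˡ _))
        (≡.trans (cong index (f-injective (injective eq))) (strictlyInverseˡ _))

    surjective⇒≡ : StrictlySurjective _≈_ f → n ≡ q
    surjective⇒≡ f-surjective = cantor-schröder-bernstein to∘f∘from-injective preimage-injective
      where
      preimage : Fin q → Fin n
      preimage k = index (proj₁ (f-surjective (element k)))
      preimage-injective : Injective _≡_ _≡_ preimage
      preimage-injective {k} {l} eq = ≡.trans (≡.sym (to∘element k)) (≡.trans (to-cong (begin
        element k                                   ≈⟨ proj₂ (f-surjective (element k)) ⟨
        f (proj₁ (f-surjective (element k)))        ≡⟨ cong f (index-injective eq) ⟩
        f (proj₁ (f-surjective (element l)))        ≈⟨ proj₂ (f-surjective (element l)) ⟩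
        element l                                   ∎)) (to∘element l))

    ≡⇒surjective : n ≡ q → Surjective _≡_ _≈_ f
    ≡⇒surjective ≡.refl y with injective⇒surjective to∘f∘from-injective (to y)
    ... | k , eq = from k , λ { ≡.refl → injective eq }

-- Labelling the prism

module _ {c ℓ} (Γ : AbelianGroup c ℓ) {q} (|Γ|≡q : HasOrder Γ q)
         {h} m (order : IsOrderOf Γ h (suc (2 * m))) (cycle : HarmoniousCycle (Γ /⟨ h ⟩)) where
  open AbelianGroup Γ
  open Order Γ order
  open HarmoniousCycle cycle renaming (length to N; vertex to X)
  open import Algebra.Properties.CommutativeSemigroup commutativeSemigroup using (interchange)
  open import Algebra.Properties.CommutativeMonoid.Mult commutativeMonoid
    using (×-homo-+) renaming (_×_ to _·_)
  open import Relation.Binary.Reasoning.Setoid setoid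

  M : ℕ
  M = suc (2 * m)

  shift : ℕ → Fin N → Fin N
  shift zero    j = j
  shift (suc i) j = cycSucc (shift i j)

  shift-cycSucc : ∀ i j → shift i (cycSucc j) ≡ cycSucc (shift i j)
  shift-cycSucc zero    j = ≡.refl
  shift-cycSucc (suc i) j = cong cycSucc (shift-cycSucc i j)

  shift-injective : ∀ i → Injective _≡_ _≡_ (shift i)
  shift-injective zero    eq = eq
  shift-injective (suc i) eq = shift-injective i (cycSucc-injective eq)

  -- Cycle edges in row i
  -- then carry 2i·h and path edges leaving row i carry (2i+1)·h, and these
  -- exponents run through 0, …, 2m exactly once.
  label : Fin (suc m) × Fin N → Carrier
  label (i , j) = X (toℕ (shift (toℕ i) j)) ∙ toℕ i · h

  Edge : Set
  Edge = Graph.Edge (Prism (suc m) N)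

  edgeLabel : Edge → Carrier
  edgeLabel e = label (proj₁ (Graph.ends (Prism (suc m) N) e)) ∙ label (proj₂ (Graph.ends (Prism (suc m) N) e))

  position : Edge → Fin N
  position (inj₁ (i , j)) = shift (toℕ i) j
  position (inj₂ (i , j)) = shift (toℕ i) j

  exponent : Edge → ℕ
  exponent (inj₁ (i , j)) = 2 * toℕ i
  exponent (inj₂ (i , j)) = suc (2 * toℕ i)

  edgeSum : ℕ → Carrier
  edgeSum a = X a ∙ X (suc a % N)

  edgeSum-cycSucc : ∀ a → X (toℕ a) ∙ X (toℕ (cycSucc a)) ≡ edgeSum (toℕ a)
  edgeSum-cycSucc a = cong (λ b → X (toℕ a) ∙ X b) (toℕ-cycSucc a)

  adjacent : ∀ a t u → X (toℕ a) ∙ t · h ∙ (X (toℕ (cycSucc a)) ∙ u · h) ≈ edgeSum (toℕ a) ∙ (t + u) · h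
  adjacent a t u = begin
    X (toℕ a) ∙ t · h ∙ (X (toℕ (cycSucc a)) ∙ u · h)  ≈⟨ interchange _ _ _ _ ⟩
    X (toℕ a) ∙ X (toℕ (cycSucc a)) ∙ (t · h ∙ u · h)  ≈⟨ ∙-cong (reflexive (edgeSum-cycSucc a)) (sym (×-homo-+ h t u)) ⟩
    edgeSum (toℕ a) ∙ (t + u) · h                     ∎

  edgeLabel-coordinates : ∀ e → edgeLabel e ≈ edgeSum (toℕ (position e)) ∙ exponent e · h
  edgeLabel-coordinates (inj₁ (i , j)) = begin
    label (i , j) ∙ label (i , cycSucc j)
      ≡⟨ cong (λ b → label (i , j) ∙ (X (toℕ b) ∙ toℕ i · h)) (shift-cycSucc (toℕ i) j) ⟩
    X (toℕ a) ∙ toℕ i · h ∙ (X (toℕ (cycSucc a)) ∙ toℕ i · h)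
      ≈⟨ adjacent a (toℕ i) (toℕ i) ⟩
    edgeSum (toℕ a) ∙ (toℕ i + toℕ i) · h
      ≡⟨ cong (λ t → edgeSum (toℕ a) ∙ (toℕ i + t) · h) (+-identityʳ (toℕ i)) ⟨
    edgeSum (toℕ a) ∙ (2 * toℕ i) · h
      ∎
    where
    a : Fin N
    a = shift (toℕ i) j
  edgeLabel-coordinates (inj₂ (i , j)) = begin
    label (inject₁ i , j) ∙ label (Fin.suc i , j)
      ≡⟨ cong (λ t → X (toℕ (shift t j)) ∙ t · h ∙ label (Fin.suc i , j)) (toℕ-inject₁ i) ⟩
    X (toℕ a) ∙ toℕ i · h ∙ (X (toℕ (cycSucc a)) ∙ suc (toℕ i) · h)
      ≈⟨ adjacent a (toℕ i) (suc (toℕ i)) ⟩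
    edgeSum (toℕ a) ∙ (toℕ i + suc (toℕ i)) · h
      ≡⟨ cong (λ t → edgeSum (toℕ a) ∙ t · h) (n+[1+n]≡1+2n (toℕ i)) ⟩
    edgeSum (toℕ a) ∙ suc (2 * toℕ i) · h
      ∎
    where
    a : Fin N
    a = shift (toℕ i) j

  row<M : ∀ (i : Fin (suc m)) → toℕ i < M
  row<M i = s≤s (≤-trans (s≤s⁻¹ (toℕ<n i)) (m≤m+n m (m + 0)))

  exponent<M : ∀ e → exponent e < M
  exponent<M (inj₁ (i , j)) = s≤s (*-monoʳ-≤ 2 (s≤s⁻¹ (toℕ<n i)))
  exponent<M (inj₂ (i , j)) = s≤s (*-monoʳ-< 2 (toℕ<n i))

  label-injective : Injective _≡_ _≈_ label
  label-injective {i , j} {i′ , j′} eq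
    with ∙·-injective vertex-injective (toℕ<n (shift (toℕ i) j)) (toℕ<n (shift (toℕ i′) j′)) (row<M i) (row<M i′) eq
  ... | a≡a′ , t≡t′ with toℕ-injective t≡t′
  ...   | ≡.refl = cong (i ,_) (shift-injective (toℕ i) (toℕ-injective a≡a′))

  edge-coordinates-injective : ∀ e e′ → position e ≡ position e′ → exponent e ≡ exponent e′ → e ≡ e′
  edge-coordinates-injective (inj₁ (i , j)) (inj₁ (i′ , j′)) p≡p′ e≡e′
    with toℕ-injective (*-cancelˡ-≡ (toℕ i) (toℕ i′) 2 e≡e′)
  ... | ≡.refl = cong (λ j → inj₁ (i , j)) (shift-injective (toℕ i) p≡p′)
  edge-coordinates-injective (inj₁ (i , _)) (inj₂ (i′ , _)) _ e≡e′ =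
    contradiction e≡e′ (even≢odd (toℕ i) (toℕ i′))
  edge-coordinates-injective (inj₂ (i , _)) (inj₁ (i′ , _)) _ e≡e′ =
    contradiction (≡.sym e≡e′) (even≢odd (toℕ i′) (toℕ i))
  edge-coordinates-injective (inj₂ (i , j)) (inj₂ (i′ , j′)) p≡p′ e≡e′
    with toℕ-injective (*-cancelˡ-≡ (toℕ i) (toℕ i′) 2 (suc-injective e≡e′))
  ... | ≡.refl = cong (λ j → inj₂ (i , j)) (shift-injective (toℕ i) p≡p′)

  edgeLabel-injective : Injective _≡_ _≈_ edgeLabel
  edgeLabel-injective {e} {e′} eq
    with ∙·-injective edge-injective (toℕ<n (position e)) (toℕ<n (position e′)) (exponent<M e) (exponent<M e′)
           (trans (sym (edgeLabel-coordinates e)) (trans eq (edgeLabel-coordinates e′)))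
  ... | p≡p′ , e≡e′ = edge-coordinates-injective e e′ (toℕ-injective p≡p′) e≡e′

  cosetCoordinates : Fin N × Fin M → Carrier
  cosetCoordinates (a , t) = X (toℕ a) ∙ toℕ t · h

  cosetCoordinates-injective : Injective _≡_ _≈_ cosetCoordinates
  cosetCoordinates-injective {a , t} {b , u} eq
    with ∙·-injective vertex-injective (toℕ<n a) (toℕ<n b) (toℕ<n t) (toℕ<n u) eq
  ... | a≡b , t≡u = cong₂ _,_ (toℕ-injective a≡b) (toℕ-injective t≡u)

  cosetCoordinates-surjective : StrictlySurjective _≈_ cosetCoordinates
  cosetCoordinates-surjective y with vertex-surjective y
  ... | a , a<N , y≈ʰXa with representative y≈ʰXa
  ...   | t , t<M , y≈Xa∙t·h = (fromℕ< a<N , fromℕ< t<M) ,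
    trans (reflexive (cong₂ (λ b u → X b ∙ u · h) (toℕ-fromℕ< a<N) (toℕ-fromℕ< t<M))) (sym y≈Xa∙t·h)

  N*M≡q : N * M ≡ q
  N*M≡q = surjective⇒≡ Γ |Γ|≡q (↔-sym *↔×) cosetCoordinates cosetCoordinates-injective cosetCoordinates-surjective

  Edge↔Fin : Edge ↔ Fin (suc m * N + m * N)
  Edge↔Fin = ↔-sym (↔-trans +↔⊎ (*↔× ⊎-↔ *↔×))

  prismLabeling : HasHarmoniousLabeling Γ (Prism (suc m) N)
  prismLabeling = label , label-injective , edgeLabel-injective ,
    ≡⇒surjective Γ |Γ|≡q Edge↔Fin edgeLabel edgeLabel-injective (≡.trans ([1+m]n+mn≡n[1+2m] m N) N*M≡q)

oddOrderPrismLabeling : ∀ {c ℓ} (Γ : AbelianGroup c ℓ) {q e} → HasOrder Γ q → q ≡ suc (2 * e) →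
                        ∀ {h m} → IsOrderOf Γ h (suc (2 * m)) →
                        ∃ λ N → N * suc (2 * m) ≡ q × HasHarmoniousLabeling Γ (Prism (suc m) N)
oddOrderPrismLabeling Γ {q} {e} |Γ|≡q q≡1+2e {h} {m} order =
  length cycle , N*M≡q Γ |Γ|≡q m order cycle , prismLabeling Γ |Γ|≡q m order cycle
  where
  open Mod Γ h using (≈⇒≈ᶻ)
  open HarmoniousCycle using (length)
  cycle : HarmoniousCycle (Γ /⟨ h ⟩)
  cycle = harmoniousCycle (Γ /⟨ h ⟩) (Order.≈ᶻ-decidable Γ order (≈-decidable Γ |Γ|≡q))
    (hasOddExponent-/⟨⟩ Γ h (odd-order⇒hasOddExponent Γ |Γ|≡q {e} q≡1+2e))
    (tabulate (element Γ |Γ|≡q)) (λ y → inj₂ (Any.map ≈⇒≈ᶻ (enumerated Γ |Γ|≡q y)))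

corollary7p4 : ∀ {c ℓ : Level} (m n k : ℕ) → n ≡ 2 * k + 1 → 3 ≤ n → 2 ≤ m →
    (Γ : AbelianGroup c ℓ) → HasOrder Γ ((2 * m ∸ 1) * n) →
    HasCyclicSubgroupOfOrder Γ (2 * m ∸ 1) →
    HasHarmoniousLabeling Γ (Prism m n)
corollary7p4 zero _ _ _ _ () _ _ _
corollary7p4 (suc m) n k n≡2k+1 _ _ Γ |Γ|≡q cyclic =
  let h , order = cyclicSubgroup⇒order Γ {suc (2 * m)} (subst (HasCyclicSubgroupOfOrder Γ) M≡1+2m cyclic)
      N , N*M≡q , labeling = oddOrderPrismLabeling Γ {e = 2 * m * k + m + k} |Γ|≡q q-odd {m = m} order
  in subst (HasHarmoniousLabeling Γ ∘ Prism (suc m))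
       (*-cancelʳ-≡ N n (suc (2 * m)) (≡.trans N*M≡q (≡.trans (cong (_* n) M≡1+2m) (*-comm (suc (2 * m)) n))))
       labeling
  where
  M≡1+2m : 2 * suc m ∸ 1 ≡ suc (2 * m)
  M≡1+2m = +-suc m (m + 0)
  q-odd : (2 * suc m ∸ 1) * n ≡ suc (2 * (2 * m * k + m + k))
  q-odd = ≡.trans (cong₂ _*_ M≡1+2m n≡2k+1) ([1+2m]*[2k+1]≡1+2[2mk+m+k] m k)
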